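{- Let $K$ be a number field, $V_K^f$ the set of its normalized non-archimedean valuations, and let $G=\{g:V_K^f\to\mathbb{Z} \ :\ g(v)\ge 0 \text{ for all but finitely many } v\}$, with pointwise addition $+$, pointwise $\wedge=\min$, $\vee=\max$, and $0$. Let $e\in G$ be an atom, i.e. a minimal element of $\{g\in G: g>0\}$; so $e$ takes the value $1$ at a single $v_0\in V_K^f$ and $0$ elsewhere. Then for $h\in G$, we have $h(w)=0$ for all $w\neq v_0$ if and only if either $h=0$, or $h\ge e$ and the interval $[e,2h]$ is linearly ordered, or $h\le -e$ and the interval $[2h,-e]$ is linearly ordered.
   Context: The order on $G$ is $g\le h$ iff $g\wedge h=g$ (i.e. pointwise). $2h=h+h$; $-e$ is the additive inverse of $e$ in $G$ (which exists since $e$ has finite support). For $a\le b$, $[a,b]=\{x\in G: a\le x\le b\}$, and "linearly ordered" means any two of its elements are comparable. -}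

module Defs where

open import Level using (Level)
open import Data.Integer using (ℤ; _≤_; _+_; -_; 0ℤ; 1ℤ)
open import Data.List using (List)
open import Data.List.Membership.Propositional using (_∈_)
open import Data.Product using (Σ; ∃; _×_; _,_)
open import Data.Sum using (_⊎_)
open import Relation.Nullary using (¬_)
open import Relation.Binary.PropositionalEquality using (_≡_)

-- The index set V (standing for V_K^f) is an arbitrary type; functions V → ℤ.
module _ {a : Level} {V : Set a} where

  -- g(v) ≥ 0 for all but finitely many v: there is a finite list of
  -- exceptions outside of which g is nonnegative.
  InG : (V → ℤ) → Set a
  InG g = Σ (List V) λ L → ∀ v → ¬ (v ∈ L) → 0ℤ ≤ g v

  G : Set a
  G = Σ (V → ℤ) InG

  _≤G_ : (V → ℤ) → (V → ℤ) → Set a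
  g ≤G h = ∀ v → g v ≤ h v

  _≈G_ : (V → ℤ) → (V → ℤ) → Set a
  g ≈G h = ∀ v → g v ≡ h v

  zeroG : V → ℤ
  zeroG _ = 0ℤ

  negG : (V → ℤ) → (V → ℤ)
  negG g v = - g v

  twice : (V → ℤ) → (V → ℤ)
  twice h v = h v + h v

  Positive : (V → ℤ) → Set a
  Positive g = (zeroG ≤G g) × ¬ (g ≈G zeroG)

  IsAtom : (V → ℤ) → Set a
  IsAtom e = InG e × Positive e
           × (∀ g → InG g → Positive g → g ≤G e → g ≈G e)

  LinOrdInterval : (V → ℤ) → (V → ℤ) → Set a
  LinOrdInterval x y =
    ∀ z w → InG z → InG w → x ≤G z → z ≤G y → x ≤G w → w ≤G y →
    (z ≤G w) ⊎ (w ≤G z)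

module Submission where

-- Proof idea.  Write "g is supported at v₀" for g(u) = 0 at every u ≠ v₀, and
-- let bump v g be g raised by one at the single point v.
--
-- * The atom e is bump v₀ 0: that function is positive, lies in G and is
--   below e, so by minimality it equals e.  Hence e is supported at v₀.
-- * Functions supported at v₀ are compared by their value at v₀, and every
--   element of an interval between two of them is again supported at v₀; so
--   such intervals are linearly ordered.  Sorting a supported h by the sign
--   of h(v₀) gives the forward direction.
-- * Conversely, if x ≤ y with x ∈ G and x < y at two distinct points v, w,
--   then bump v x and bump w x are two incomparable elements of [x, y].  If
--   h(w) ≠ 0 for some w ≠ v₀, this applies to [e, 2h] (when e ≤ h) and to
--   [2h, -e] (when h ≤ -e), at the points v₀ and w; this is the backward
--   direction.

open import Defs
open import Level using (Level)
open import Data.Integer using (ℤ; 0ℤ; 1ℤ; -1ℤ; _+_; -_; _≤_; _<_)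
  renaming (suc to sucℤ)
open import Data.Integer.Properties
  using (≤-refl; ≤-trans; ≤-reflexive; ≤-antisym; ≤-total; ≤-<-trans;
         <-cmp; i≮i; ≤∧≢⇒<; +-mono-≤; +-mono-<; +-mono-≤-<; +-identityʳ;
         neg-mono-≤; i≤suc[i]; i<j⇒suc[i]≤j; suc[i]≤j⇒i<j; i<j⇒i≤pred[j])
  renaming (_≟_ to _≟ℤ_)
open import Data.List using ([])
open import Data.Product using (_×_; _,_; proj₁; proj₂)
open import Data.Sum using (_⊎_; inj₁; inj₂)
import Data.Sum as Sum
open import Function using (_∘_)
open import Function.Bundles using (_⇔_; mk⇔)
open import Relation.Nullary using (¬_; yes; no; contradiction)
open import Relation.Nullary.Decidable using (decidable-stable)
open import Relation.Binary.Definitions using (DecidableEquality; tri<; tri≈; tri>)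
open import Relation.Binary.PropositionalEquality
  using (_≡_; refl; sym; trans; cong; cong₂; subst; subst₂)

≤-double : ∀ {i j} → i ≤ j → 0ℤ ≤ j → i ≤ j + j
≤-double {i} {j} i≤j 0≤j = subst (_≤ j + j) (+-identityʳ i) (+-mono-≤ i≤j 0≤j)

double-≤ : ∀ {i j} → i ≤ j → i ≤ 0ℤ → i + i ≤ j
double-≤ {i} {j} i≤j i≤0 = subst (i + i ≤_) (+-identityʳ j) (+-mono-≤ i≤j i≤0)

1<i+i : ∀ {i} → 1ℤ ≤ i → 1ℤ < i + i
1<i+i 1≤i = +-mono-≤-< 1≤i (suc[i]≤j⇒i<j {0ℤ} 1≤i)

i+i<-1 : ∀ {i} → i ≤ -1ℤ → i + i < -1ℤ
i+i<-1 i≤-1 = +-mono-≤-< i≤-1 (≤-<-trans i≤-1 (suc[i]≤j⇒i<j { -1ℤ} {0ℤ} ≤-refl))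

InG-twice : ∀ {a} {V : Set a} {h : V → ℤ} → InG h → InG (twice h)
InG-twice (L , h≥0) = L , λ u u∉L → +-mono-≤ (h≥0 u u∉L) (h≥0 u u∉L)

module Pointwise {a : Level} {V : Set a} (_≟_ : DecidableEquality V) where

  bump : V → (V → ℤ) → V → ℤ
  bump v g u with u ≟ v
  ... | yes _ = sucℤ (g u)
  ... | no  _ = g u

  bump-at : ∀ v g → bump v g v ≡ sucℤ (g v)
  bump-at v g with v ≟ v
  ... | yes _   = refl
  ... | no  v≢v = contradiction refl v≢v

  bump-off : ∀ {v u} g → ¬ (u ≡ v) → bump v g u ≡ g u
  bump-off {v} {u} g u≢v with u ≟ v
  ... | yes u≡v = contradiction u≡v u≢v
  ... | no  _   = refl

  bump-increasing : ∀ v g → g ≤G bump v g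
  bump-increasing v g u with u ≟ v
  ... | yes _ = i≤suc[i] (g u)
  ... | no  _ = ≤-refl

  bump-≤ : ∀ {v g y} → g v < y v → g ≤G y → bump v g ≤G y
  bump-≤ {v} gv<yv g≤y u with u ≟ v
  ... | yes refl = i<j⇒suc[i]≤j gv<yv
  ... | no  _    = g≤y u

  InG-bump : ∀ {g} v → InG g → InG (bump v g)
  InG-bump {g} v (L , g≥0) = L , λ u u∉L → ≤-trans (g≥0 u u∉L) (bump-increasing v g u)

  bump-incomparable : ∀ {v w} g → ¬ (v ≡ w) → ¬ (bump v g ≤G bump w g)
  bump-incomparable {v} {w} g v≢w bv≤bw =
    i≮i (suc[i]≤j⇒i<j (subst₂ _≤_ (bump-at v g) (bump-off g v≢w) (bv≤bw v)))

  -- Key obstruction: an interval [x, y] with x ∈ G and x < y at two distinct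
  -- points contains the two incomparable bumps of x at those points.
  interval-not-linear : ∀ {x y v w} → InG x → x ≤G y → ¬ (v ≡ w) →
                        x v < y v → x w < y w → ¬ LinOrdInterval x y
  interval-not-linear {x} {y} {v} {w} xG x≤y v≢w xv<yv xw<yw lin
    with lin (bump v x) (bump w x) (InG-bump v xG) (InG-bump w xG)
             (bump-increasing v x) (bump-≤ xv<yv x≤y)
             (bump-increasing w x) (bump-≤ xw<yw x≤y)
  ... | inj₁ bv≤bw = bump-incomparable x v≢w bv≤bw
  ... | inj₂ bw≤bv = bump-incomparable x (v≢w ∘ sym) bw≤bv

  SupportedAt : V → (V → ℤ) → Set a
  SupportedAt v₀ g = ∀ u → ¬ (u ≡ v₀) → g u ≡ 0ℤ

  module _ {v₀ : V} where

    twice-supported : ∀ {g} → SupportedAt v₀ g → SupportedAt v₀ (twice g)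
    twice-supported g-supp u u≢v₀ = cong₂ _+_ (g-supp u u≢v₀) (g-supp u u≢v₀)

    negG-supported : ∀ {g} → SupportedAt v₀ g → SupportedAt v₀ (negG g)
    negG-supported g-supp u u≢v₀ = cong -_ (g-supp u u≢v₀)

    supported-zero : ∀ {g} → SupportedAt v₀ g → g v₀ ≡ 0ℤ → g ≈G zeroG
    supported-zero g-supp g[v₀]≡0 u with u ≟ v₀
    ... | yes refl = g[v₀]≡0
    ... | no  u≢v₀ = g-supp u u≢v₀

    supported-≤ : ∀ {g h} → SupportedAt v₀ g → SupportedAt v₀ h →
                  g v₀ ≤ h v₀ → g ≤G h
    supported-≤ g-supp h-supp g≤h u with u ≟ v₀
    ... | yes refl = g≤h
    ... | no  u≢v₀ = ≤-reflexive (trans (g-supp u u≢v₀) (sym (h-supp u u≢v₀)))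

    supported-squeeze : ∀ {x y z} → SupportedAt v₀ x → SupportedAt v₀ y →
                        x ≤G z → z ≤G y → SupportedAt v₀ z
    supported-squeeze {x} {y} {z} x-supp y-supp x≤z z≤y u u≢v₀ =
      ≤-antisym (subst (z u ≤_) (y-supp u u≢v₀) (z≤y u))
                (subst (_≤ z u) (x-supp u u≢v₀) (x≤z u))

    supported-interval-linear : ∀ {x y} → SupportedAt v₀ x → SupportedAt v₀ y →
                                LinOrdInterval x y
    supported-interval-linear x-supp y-supp z w _ _ x≤z z≤y x≤w w≤y =
      Sum.map (supported-≤ z-supp w-supp) (supported-≤ w-supp z-supp)
              (≤-total (z v₀) (w v₀))
      where
      z-supp : SupportedAt v₀ z
      z-supp = supported-squeeze x-supp y-supp x≤z z≤y
      w-supp : SupportedAt v₀ w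
      w-supp = supported-squeeze x-supp y-supp x≤w w≤y

  -- An atom taking the value 1 at v₀ is supported at v₀: the positive
  -- element bump v₀ 0 of G lies below it, so equals it by minimality.
  atom-supported : ∀ {e v₀} → IsAtom e → e v₀ ≡ 1ℤ → SupportedAt v₀ e
  atom-supported {e} {v₀} (_ , (e≥0 , _) , minimal) e[v₀]≡1 u u≢v₀ =
    trans (sym (δ≈e u)) (bump-off zeroG u≢v₀)
    where
    δ : V → ℤ
    δ = bump v₀ zeroG
    δ-positive : Positive δ
    δ-positive = bump-increasing v₀ zeroG , λ δ≈0 → 1≢0 (trans (sym (bump-at v₀ zeroG)) (δ≈0 v₀))
      where
      1≢0 : ¬ (1ℤ ≡ 0ℤ)
      1≢0 ()
    δ≤e : δ ≤G e
    δ≤e = bump-≤ (subst (0ℤ <_) (sym e[v₀]≡1) (suc[i]≤j⇒i<j ≤-refl)) e≥0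
    δ≈e : δ ≈G e
    δ≈e = minimal δ (InG-bump v₀ ([] , λ _ _ → ≤-refl)) δ-positive δ≤e

module SingleAtom {a : Level} {V : Set a} (_≟_ : DecidableEquality V)
                  {e : V → ℤ} (atom : IsAtom e) {v₀ : V} (e[v₀]≡1 : e v₀ ≡ 1ℤ) where

  open Pointwise _≟_

  e-supported : SupportedAt v₀ e
  e-supported = atom-supported atom e[v₀]≡1

  e≥0 : zeroG ≤G e
  e≥0 = proj₁ (proj₁ (proj₂ atom))

  -e[v₀]≡-1 : negG e v₀ ≡ -1ℤ
  -e[v₀]≡-1 = cong -_ e[v₀]≡1

  supported-classification : ∀ {h} → SupportedAt v₀ h →
    (h ≈G zeroG)
    ⊎ ((e ≤G h) × LinOrdInterval e (twice h))
    ⊎ ((h ≤G negG e) × LinOrdInterval (twice h) (negG e))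
  supported-classification {h} h-supp with <-cmp (h v₀) 0ℤ
  ... | tri< h[v₀]<0 _ _ = inj₂ (inj₂
        ( supported-≤ h-supp (negG-supported e-supported)
            (subst (h v₀ ≤_) (sym -e[v₀]≡-1) (i<j⇒i≤pred[j] h[v₀]<0))
        , supported-interval-linear (twice-supported h-supp) (negG-supported e-supported)))
  ... | tri≈ _ h[v₀]≡0 _ = inj₁ (supported-zero h-supp h[v₀]≡0)
  ... | tri> _ _ 0<h[v₀] = inj₂ (inj₁
        ( supported-≤ e-supported h-supp
            (subst (_≤ h v₀) (sym e[v₀]≡1) (i<j⇒suc[i]≤j 0<h[v₀]))
        , supported-interval-linear e-supported (twice-supported h-supp)))

  -- Backward direction, case e ≤ h: a nonzero value h(w), w ≠ v₀, makes
  -- e < 2h at both v₀ and w, so [e, 2h] is not linearly ordered.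
  above-atom-supported : ∀ {h} → e ≤G h → LinOrdInterval e (twice h) → SupportedAt v₀ h
  above-atom-supported {h} e≤h lin w w≢v₀ = decidable-stable (h w ≟ℤ 0ℤ) λ h[w]≢0 →
    interval-not-linear (proj₁ atom) e≤2h (w≢v₀ ∘ sym)
      (subst (_< twice h v₀) (sym e[v₀]≡1) (1<i+i (subst (_≤ h v₀) e[v₀]≡1 (e≤h v₀))))
      (subst (_< twice h w) (sym (e-supported w w≢v₀)) (+-mono-< (0<h[w] h[w]≢0) (0<h[w] h[w]≢0)))
      lin
    where
    h≥0 : zeroG ≤G h
    h≥0 u = ≤-trans (e≥0 u) (e≤h u)
    e≤2h : e ≤G twice h
    e≤2h u = ≤-double (e≤h u) (h≥0 u)
    0<h[w] : ¬ (h w ≡ 0ℤ) → 0ℤ < h w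
    0<h[w] h[w]≢0 = ≤∧≢⇒< (h≥0 w) (h[w]≢0 ∘ sym)

  -- Backward direction, case h ≤ -e: symmetrically 2h < -e at v₀ and w.
  below-atom-supported : ∀ {h} → InG h → h ≤G negG e → LinOrdInterval (twice h) (negG e) →
                         SupportedAt v₀ h
  below-atom-supported {h} hG h≤-e lin w w≢v₀ = decidable-stable (h w ≟ℤ 0ℤ) λ h[w]≢0 →
    interval-not-linear (InG-twice hG) 2h≤-e (w≢v₀ ∘ sym)
      (subst (twice h v₀ <_) (sym -e[v₀]≡-1) (i+i<-1 (subst (h v₀ ≤_) -e[v₀]≡-1 (h≤-e v₀))))
      (subst (twice h w <_) (sym (negG-supported e-supported w w≢v₀))
             (+-mono-< (h[w]<0 h[w]≢0) (h[w]<0 h[w]≢0)))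
      lin
    where
    h≤0 : h ≤G zeroG
    h≤0 u = ≤-trans (h≤-e u) (neg-mono-≤ (e≥0 u))
    2h≤-e : twice h ≤G negG e
    2h≤-e u = double-≤ (h≤-e u) (h≤0 u)
    h[w]<0 : ¬ (h w ≡ 0ℤ) → h w < 0ℤ
    h[w]<0 h[w]≢0 = ≤∧≢⇒< (h≤0 w) h[w]≢0

mainTheorem2 : ∀ {a : Level} (V : Set a) → DecidableEquality V →
    (e : V → ℤ) → IsAtom e → (v₀ : V) → e v₀ ≡ 1ℤ →
    (h : V → ℤ) → InG h →
    ((∀ w → ¬ (w ≡ v₀) → h w ≡ 0ℤ)
    ⇔ ((h ≈G zeroG)
    ⊎ ((e ≤G h) × LinOrdInterval e (twice h))
    ⊎ ((h ≤G negG e) × LinOrdInterval (twice h) (negG e))))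
mainTheorem2 V _≟_ e atom v₀ e[v₀]≡1 h hG =
  mk⇔ supported-classification λ
    { (inj₁ h≈0)                → λ w _ → h≈0 w
    ; (inj₂ (inj₁ (e≤h , lin)))  → above-atom-supported e≤h lin
    ; (inj₂ (inj₂ (h≤-e , lin))) → below-atom-supported hG h≤-e lin
    }
  where
  open SingleAtom _≟_ atom e[v₀]≡1
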